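{- Let $P$ be a finite poset and $k\ge1$. There is a bijection $\phi:\mathcal{F}_k(P)\to\mathcal{J}(P\times[k])$ such that for every $x\in P$, $\phi\circ w_x=\tau_{(x,1)}\circ\tau_{(x,2)}\circ\cdots\circ\tau_{(x,k)}\circ\phi$.
   Context: $\mathcal{F}_k(P)$ is the set of functions $f:P\to\{0,1,\dots,k\}$ with $x\le_P y\Rightarrow f(x)\ge f(y)$. For $x\in P$, $w_x:\mathcal{F}_k(P)\to\mathcal{F}_k(P)$ repeatedly adds $1$ modulo $k+1$ to $f(x)$ (other values unchanged) until the result lies in $\mathcal{F}_k(P)$. $P\times[k]$ has the product order, $\mathcal{J}(Q)$ denotes the order ideals of $Q$. For $y\in Q$ the toggle $\tau_y:\mathcal{J}(Q)\to\mathcal{J}(Q)$ is: $\tau_y(I)=I\setminus\{y\}$ if $y\in I$ and $I\setminus\{y\}\in\mathcal{J}(Q)$; $\tau_y(I)=I\cup\{y\}$ if $y\notin I$ and $I\cup\{y\}\in\mathcal{J}(Q)$; $\tau_y(I)=I$ otherwise. -}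

module Defs where

open import Level using (0ℓ)
open import Data.Nat using (ℕ; zero; suc)
open import Data.Fin using (Fin; zero; suc) renaming (_≤_ to _≤ᶠ_)
open import Data.Fin.Properties using (all?) renaming (_≤?_ to _≤ᶠ?_)
open import Data.Bool using (Bool; true; false; not; if_then_else_)
open import Data.Bool.Properties using () renaming (_≟_ to _≟ᵇ_)
open import Data.Vec using (Vec; lookup; _[_]%=_)
open import Data.List using (List; foldr; allFin)
open import Data.Product using (_×_)
open import Function using (_∘_; id)
open import Relation.Binary.PropositionalEquality using (_≡_)
open import Relation.Binary.Structures using (IsDecPartialOrder)
open import Relation.Nullary using (Dec; yes; no; does)
open import Relation.Nullary.Decidable using (_→-dec_; _×-dec_)

record FinPoset : Set₁ where
  field
    size  : ℕ
    _≤P_  : Fin size → Fin size → Set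
    isDecPartialOrder : IsDecPartialOrder _≡_ _≤P_
  open IsDecPartialOrder isDecPartialOrder public using () renaming (_≤?_ to _≤P?_)

module _ (P : FinPoset) where
  open FinPoset P

  InF : (k : ℕ) → Vec (Fin (suc k)) size → Set
  InF k f = ∀ x y → x ≤P y → lookup f y ≤ᶠ lookup f x

  InF? : (k : ℕ) (f : Vec (Fin (suc k)) size) → Dec (InF k f)
  InF? k f = all? λ x → all? λ y → (x ≤P? y) →-dec (lookup f y ≤ᶠ? lookup f x)

incMod : ∀ {m} → Fin (suc m) → Fin (suc m)
incMod {zero} zero = zero
incMod {suc m} zero = suc zero
incMod {suc m} (suc i) with incMod {m} i
... | zero  = zero
... | suc j = suc (suc j)

module _ (P : FinPoset) where
  open FinPoset P

  -- For f ∈ F_k(P) this stops after at most k+1 steps (returning to f);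
  -- the fuel (k+1) is therefore never exhausted on F_k(P).
  wStep : (k : ℕ) → Fin size → ℕ → Vec (Fin (suc k)) size → Vec (Fin (suc k)) size
  wStep k x zero    g = g
  wStep k x (suc m) g with does (InF? P k (g [ x ]%= incMod))
  ... | true  = g [ x ]%= incMod
  ... | false = wStep k x m (g [ x ]%= incMod)

  w : (k : ℕ) → Fin size → Vec (Fin (suc k)) size → Vec (Fin (suc k)) size
  w k x f = wStep k x (suc k) f

  -- Subsets of P × [k]: I[x][i] = true iff (x , i+1) ∈ I  ([k] = {1,...,k} ≅ Fin k).
  Sub : ℕ → Set
  Sub k = Vec (Vec Bool k) size

  _∈S_ : ∀ {k} → Fin size × Fin k → Sub k → Set
  _∈S_ (x Data.Product., i) I = lookup (lookup I x) i ≡ true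

  IsIdeal : (k : ℕ) → Sub k → Set
  IsIdeal k I = ∀ x y (i j : Fin k) → x ≤P y → i ≤ᶠ j →
                lookup (lookup I y) j ≡ true → lookup (lookup I x) i ≡ true

  IsIdeal? : (k : ℕ) (I : Sub k) → Dec (IsIdeal k I)
  IsIdeal? k I = all? λ x → all? λ y → all? λ i → all? λ j →
    (x ≤P? y) →-dec ((i ≤ᶠ? j) →-dec
      ((lookup (lookup I y) j ≟ᵇ true) →-dec (lookup (lookup I x) i ≟ᵇ true)))

  setAt : ∀ {k} → Fin size → Fin k → Bool → Sub k → Sub k
  setAt x i b I = I [ x ]%= (λ row → row [ i ]%= λ _ → b)

  toggle : (k : ℕ) → Fin size → Fin k → Sub k → Sub k
  toggle k x i I with lookup (lookup I x) i
  ... | true  = if does (IsIdeal? k (setAt x i false I)) then setAt x i false I else I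
  ... | false = if does (IsIdeal? k (setAt x i true I))  then setAt x i true I  else I

  toggleCol : (k : ℕ) → Fin size → Sub k → Sub k
  toggleCol k x = foldr (λ i g → toggle k x i ∘ g) id (allFin k)

{-# OPTIONS --safe #-}
-- Fix f away from x.  The values v for which f [ x ]≔ v stays order-reversing form an interval
-- [lo , hi] containing c = f x, so w_x sends c to c + 1 if c < hi and otherwise wraps around to lo.
-- Row x of φ f is the segment {1, …, c} of [k].  The toggles τ_(x,k), …, τ_(x,1) are applied
-- top-down, and τ_(x,i) can only act when i = c + 1 (adding (x , c + 1), allowed iff c < hi) or
-- i = c (removing (x , c), allowed iff lo < c).  So the row grows by one if it can, and otherwise
-- shrinks step by step down to lo: it ends at the same value as w_x.
module Submission where

open import Defs
open import Level using (0ℓ)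
open import Data.Nat using (ℕ; zero; suc; _+_; _∸_; _≤_; _<_; z≤n; s≤s)
open import Data.Nat.Properties
open import Data.Fin using (Fin; zero; suc; toℕ; fromℕ<; inject₁) renaming (_≤_ to _≤ᶠ_; _<_ to _<ᶠ_)
open import Data.Fin.Properties
  using (toℕ-injective; toℕ≤pred[n]; toℕ-fromℕ<; toℕ-inject₁; toℕ-inject; ¬∀⟶∃¬-smallest)
  renaming (_≟_ to _≟ᶠ_)
open import Data.Vec using (Vec; []; _∷_; lookup; map; _[_]%=_; _[_]≔_)
open import Data.Vec.Properties
  using (lookup-map; map-∘; map-cong; map-id; map-[]≔; lookup∘update; lookup∘update′; lookup∘updateAt;
         []≔-lookup; updateAt-updateAt; updateAt-updateAt-local; updateAt-cong-local)
open import Data.List using ([]; _∷_; _∷ʳ_; foldr; allFin; take)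
open import Data.List.Properties using (foldr-∷ʳ; foldr-fusion; take-suc-tabulate; take-all; length-tabulate)
open import Data.Bool using (Bool; true; false; not; if_then_else_)
open import Data.Bool.Properties using (if-float; if-cong-else)
open import Data.Product using (Σ; ∃; _×_; _,_)
open import Data.Sum using (_⊎_; inj₁; inj₂; [_,_]′)
open import Function using (_∘_; id; _⇔_; mk⇔)
open import Relation.Binary.Definitions using (tri<; tri≈; tri>)
open import Relation.Binary.PropositionalEquality
open import Relation.Binary.Structures using (IsDecPartialOrder)
open import Relation.Nullary using (yes; no; does; ¬_; ¬?; contradiction)
open import Relation.Nullary.Decidable using (dec-true; dec-false; does-⇔; decidable-stable)
open import Relation.Unary using (Pred; Decidable)

open ≡-Reasoning

away-from-neighbours : ∀ {a b} → a ≢ b → suc a ≢ b → b < a ⊎ suc a < b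
away-from-neighbours {a} {b} a≢b 1+a≢b with <-cmp a b
... | tri< a<b _ _ = inj₂ (≤∧≢⇒< a<b 1+a≢b)
... | tri≈ _ a≡b _ = contradiction a≡b a≢b
... | tri> _ _ b<a = inj₁ b<a

toℕ-incMod : ∀ {m} (c : Fin (suc m)) → toℕ c < m → toℕ (incMod c) ≡ suc (toℕ c)
toℕ-incMod {suc m} zero    _         = refl
toℕ-incMod {suc m} (suc c) (s≤s c<m) with incMod c | toℕ-incMod c c<m
... | suc _ | eq = cong suc eq

incMod-wrap : ∀ {m} (c : Fin (suc m)) → toℕ c ≡ m → incMod c ≡ zero
incMod-wrap {zero}  zero    _  = refl
incMod-wrap {suc m} (suc c) eq with incMod c | incMod-wrap c (suc-injective eq)
... | zero | _ = refl

segment : ∀ {k} → Fin (suc k) → Vec Bool k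
segment {zero}  _       = []
segment {suc k} zero    = false ∷ segment zero
segment {suc k} (suc c) = true ∷ segment c

leadingTrues : ∀ {k} → Vec Bool k → Fin (suc k)
leadingTrues []          = zero
leadingTrues (true ∷ r)  = suc (leadingTrues r)
leadingTrues (false ∷ r) = zero

leadingTrues-segment : ∀ {k} (c : Fin (suc k)) → leadingTrues (segment c) ≡ c
leadingTrues-segment {zero}  zero    = refl
leadingTrues-segment {suc k} zero    = refl
leadingTrues-segment {suc k} (suc c) = cong suc (leadingTrues-segment c)

segment-true : ∀ {k} {c : Fin (suc k)} {i : Fin k} → i <ᶠ c → lookup (segment c) i ≡ true
segment-true {c = suc c} {zero}  _         = refl
segment-true {c = suc c} {suc i} (s≤s i<c) = segment-true i<c

segment-false : ∀ {k} {c : Fin (suc k)} {i : Fin k} → c ≤ᶠ i → lookup (segment c) i ≡ false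
segment-false {c = zero}  {zero}  _         = refl
segment-false {c = zero}  {suc i} _         = segment-false {c = zero} {i} z≤n
segment-false {c = suc c} {suc i} (s≤s c≤i) = segment-false c≤i

segment-true⁻¹ : ∀ {k} {c : Fin (suc k)} {i : Fin k} → lookup (segment c) i ≡ true → i <ᶠ c
segment-true⁻¹ {c = zero}  {i}     h = contradiction (trans (sym (segment-false {c = zero} {i} z≤n)) h) λ ()
segment-true⁻¹ {c = suc c} {zero}  _ = s≤s z≤n
segment-true⁻¹ {c = suc c} {suc i} h = s≤s (segment-true⁻¹ h)

infix 4 _≼_

-- IsIdeal I says exactly that lookup I y ≼ lookup I x whenever x ≤P y.
_≼_ : ∀ {k} → Vec Bool k → Vec Bool k → Set
r ≼ s = ∀ i j → i ≤ᶠ j → lookup r j ≡ true → lookup s i ≡ true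

DownClosed : ∀ {k} → Vec Bool k → Set
DownClosed r = r ≼ r

≼-tail : ∀ {k} {a b} {r s : Vec Bool k} → a ∷ r ≼ b ∷ s → r ≼ s
≼-tail h i j i≤j = h (suc i) (suc j) (s≤s i≤j)

segment-≼ : ∀ {k} {c d : Fin (suc k)} → d ≤ᶠ c → segment d ≼ segment c
segment-≼ d≤c i j i≤j j∈d = segment-true (≤-<-trans i≤j (<-≤-trans (segment-true⁻¹ j∈d) d≤c))

segment-≼⁻¹ : ∀ {k} {c d : Fin (suc k)} → segment d ≼ segment c → d ≤ᶠ c
segment-≼⁻¹ {c = zero}  {zero}  _ = z≤n
segment-≼⁻¹ {suc k} {c = zero} {suc d} h = contradiction (h zero zero z≤n refl) λ ()
segment-≼⁻¹ {c = suc c} {zero}  _ = z≤n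
segment-≼⁻¹ {suc k} {c = suc c} {suc d} h = s≤s (segment-≼⁻¹ (≼-tail h))

segment-zero : ∀ {k} (r : Vec Bool k) → (∀ j → lookup r j ≢ true) → segment zero ≡ r
segment-zero []          _ = refl
segment-zero (true ∷ r)  h = contradiction refl (h zero)
segment-zero (false ∷ r) h = cong (false ∷_) (segment-zero r (h ∘ suc))

segment-leadingTrues : ∀ {k} (r : Vec Bool k) → DownClosed r → segment (leadingTrues r) ≡ r
segment-leadingTrues []          _ = refl
segment-leadingTrues (true ∷ r)  h = cong (true ∷_) (segment-leadingTrues r (≼-tail h))
segment-leadingTrues (false ∷ r) h =
  cong (false ∷_) (segment-zero r λ j j∈r → contradiction (h zero (suc j) z≤n j∈r) λ ())

segment-raise : ∀ {k} (i : Fin k) → segment (inject₁ i) [ i ]%= not ≡ segment (suc i)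
segment-raise zero    = refl
segment-raise (suc i) = cong (true ∷_) (segment-raise i)

segment-lower : ∀ {k} (i : Fin k) → segment (suc i) [ i ]%= not ≡ segment (inject₁ i)
segment-lower zero    = refl
segment-lower (suc i) = cong (true ∷_) (segment-lower i)

segment-flip-above : ∀ {k} {e : Fin (suc k)} {i : Fin k} → e <ᶠ i → ¬ DownClosed (segment e [ i ]%= not)
segment-flip-above {suc k} {zero} {suc i} _ h = contradiction (h zero (suc i) z≤n i∈flip) λ ()
  where
    i∈flip : lookup (segment zero [ i ]%= not) i ≡ true
    i∈flip = trans (lookup∘updateAt i (segment zero)) (cong not (segment-false {c = zero} {i} z≤n))
segment-flip-above {suc k} {suc e} {suc i} (s≤s e<i) h = segment-flip-above e<i (≼-tail h)

segment-flip-below : ∀ {k} {e : Fin (suc k)} {i : Fin k} → suc i <ᶠ e → ¬ DownClosed (segment e [ i ]%= not)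
segment-flip-below {e = suc zero} {zero} (s≤s ())
segment-flip-below {suc (suc k)} {suc (suc e)} {zero} _ h = contradiction (h zero (suc zero) z≤n refl) λ ()
segment-flip-below {suc k} {suc e} {suc i} (s≤s i<e) h = segment-flip-below i<e (≼-tail h)

idealOf : ∀ {n k} → Vec (Fin (suc k)) n → Vec (Vec Bool k) n
idealOf = map segment

fromIdeal : ∀ {n k} → Vec (Vec Bool k) n → Vec (Fin (suc k)) n
fromIdeal = map leadingTrues

fromIdeal-idealOf : ∀ {n k} (g : Vec (Fin (suc k)) n) → fromIdeal (idealOf g) ≡ g
fromIdeal-idealOf g = begin
  map leadingTrues (map segment g)    ≡⟨ map-∘ leadingTrues segment g ⟨
  map (leadingTrues ∘ segment) g      ≡⟨ map-cong leadingTrues-segment g ⟩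
  map id g                            ≡⟨ map-id g ⟩
  g                                   ∎

idealOf-injective : ∀ {n k} {g h : Vec (Fin (suc k)) n} → idealOf g ≡ idealOf h → g ≡ h
idealOf-injective {g = g} {h} eq = begin
  g                      ≡⟨ fromIdeal-idealOf g ⟨
  fromIdeal (idealOf g)  ≡⟨ cong fromIdeal eq ⟩
  fromIdeal (idealOf h)  ≡⟨ fromIdeal-idealOf h ⟩
  h                      ∎

idealOf-fromIdeal : ∀ {n k} (I : Vec (Vec Bool k) n) → (∀ x → DownClosed (lookup I x)) →
                    idealOf (fromIdeal I) ≡ I
idealOf-fromIdeal []      _ = refl
idealOf-fromIdeal (r ∷ I) h = cong₂ _∷_ (segment-leadingTrues r (h zero)) (idealOf-fromIdeal I (h ∘ suc))

-- V is the set of admissible values of f x when f is fixed elsewhere; wValue, toggleValue i and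
-- sweepValue are the effect of w_x, τ_(x,i+1) and τ_(x,1) ∘ ⋯ ∘ τ_(x,k) on that value.
module Column {k : ℕ} (V : Pred (Fin (suc k)) 0ℓ) (V? : Decidable V) where

  validOr : Fin (suc k) → Fin (suc k) → Fin (suc k)
  validOr d e = if does (V? d) then d else e

  validOr-valid : ∀ {d e} → V d → validOr d e ≡ d
  validOr-valid {d} vd rewrite dec-true (V? d) vd = refl

  validOr-invalid : ∀ {d e} → ¬ V d → validOr d e ≡ e
  validOr-invalid {d} ¬vd rewrite dec-false (V? d) ¬vd = refl

  validOr-elim : ∀ {ℓ} (Q : Fin (suc k) → Set ℓ) {d e} →
                 (V d → Q d) → (¬ V d → Q e) → Q (validOr d e)
  validOr-elim Q {d} if-valid if-invalid with V? d
  ... | yes vd  = if-valid vd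
  ... | no ¬vd  = if-invalid ¬vd

  wValue : ℕ → Fin (suc k) → Fin (suc k)
  wValue zero    u = u
  wValue (suc m) u = validOr (incMod u) (wValue m (incMod u))

  toggleValue : Fin k → Fin (suc k) → Fin (suc k)
  toggleValue i e with toℕ i ≟ toℕ e | suc (toℕ i) ≟ toℕ e
  ... | yes _ | _     = validOr (suc i) e
  ... | no _  | yes _ = validOr (inject₁ i) e
  ... | no _  | no _  = e

  sweepUpTo : ℕ → Fin (suc k) → Fin (suc k)
  sweepUpTo n = foldr (λ i g → toggleValue i ∘ g) id (take n (allFin k))

  sweepValue : Fin (suc k) → Fin (suc k)
  sweepValue = foldr (λ i g → toggleValue i ∘ g) id (allFin k)

  InvalidBelow InvalidAbove Least : Fin (suc k) → Set
  InvalidBelow u = ∀ v → v <ᶠ u → ¬ V v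
  InvalidAbove u = ∀ v → u <ᶠ v → ¬ V v
  Least r = V r × InvalidBelow r

  Convex : Set
  Convex = ∀ {u v t} → V u → V t → u ≤ᶠ v → v ≤ᶠ t → V v

  least-exists : ∀ {c} → V c → ∃ Least
  least-exists {c} vc with ¬∀⟶∃¬-smallest (suc k) (¬_ ∘ V) (¬? ∘ V?) (λ none → none c vc)
  ... | r , ¬¬vr , below = r , decidable-stable (V? r) ¬¬vr , invalid
    where
      invalid : InvalidBelow r
      invalid v v<r = subst (¬_ ∘ V) (toℕ-injective (trans (toℕ-inject j) (toℕ-fromℕ< v<r))) (below j)
        where
          j : Fin (toℕ r)
          j = fromℕ< v<r

  least-unique : ∀ {r s} → Least r → Least s → r ≡ s
  least-unique (vr , below-r) (vs , below-s) =
    toℕ-injective (≤-antisym (≮⇒≥ λ s<r → below-r _ s<r vs) (≮⇒≥ λ r<s → below-s _ r<s vr))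

  invalidBelow-convex : Convex → ∀ {d e} → V e → ¬ V d → suc (toℕ d) ≡ toℕ e → InvalidBelow e
  invalidBelow-convex convex ve ¬vd d⁺≡e v v<e vv =
    ¬vd (convex vv ve (≤-pred (subst (toℕ v <_) (sym d⁺≡e) v<e))
                      (≤-trans (n≤1+n _) (≤-reflexive d⁺≡e)))

  invalidAbove-convex : Convex → ∀ {c d} → V c → ¬ V d → suc (toℕ c) ≡ toℕ d → InvalidAbove c
  invalidAbove-convex convex vc ¬vd c⁺≡d v c<v vv =
    ¬vd (convex vc vv (≤-trans (n≤1+n _) (≤-reflexive c⁺≡d)) (subst (_≤ toℕ v) c⁺≡d c<v))

  wValue-climb : ∀ {r} → Least r → ∀ d u → toℕ u + d ≡ toℕ r → ∀ extra →
                 validOr u (wValue (d + extra) u) ≡ r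
  wValue-climb (vr , _) zero u u≡r _
    rewrite toℕ-injective {i = u} (trans (sym (+-identityʳ (toℕ u))) u≡r) = validOr-valid vr
  wValue-climb {r} least@(_ , below) (suc d) u u+d⁺≡r extra = begin
    validOr u (wValue (suc d + extra) u)  ≡⟨ validOr-invalid (below u u<r) ⟩
    wValue (suc d + extra) u              ≡⟨ wValue-climb least d (incMod u) u⁺+d≡r extra ⟩
    r                                     ∎
    where
      u<r : u <ᶠ r
      u<r = subst (toℕ u <_) u+d⁺≡r (m<m+n (toℕ u) (s≤s z≤n))
      u⁺+d≡r : toℕ (incMod u) + d ≡ toℕ r
      u⁺+d≡r = begin
        toℕ (incMod u) + d  ≡⟨ cong (_+ d) (toℕ-incMod u (<-≤-trans u<r (toℕ≤pred[n] r))) ⟩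
        suc (toℕ u) + d     ≡⟨ +-suc (toℕ u) d ⟨
        toℕ u + suc d       ≡⟨ u+d⁺≡r ⟩
        toℕ r               ∎

  wValue-wrap : ∀ {r} → Least r → ∀ d u → toℕ u + d ≡ k → InvalidAbove u → ∀ extra →
                wValue (suc (d + toℕ r + extra)) u ≡ r
  wValue-wrap {r} least zero u u≡k _ extra
    rewrite incMod-wrap u (trans (sym (+-identityʳ (toℕ u))) u≡k) = wValue-climb least (toℕ r) zero refl extra
  wValue-wrap {r} least (suc d) u u+d⁺≡k above extra = begin
    validOr (incMod u) (wValue (suc d + toℕ r + extra) (incMod u))
      ≡⟨ validOr-invalid (above _ u<u⁺) ⟩
    wValue (suc (d + toℕ r + extra)) (incMod u)
      ≡⟨ wValue-wrap least d (incMod u) u⁺+d≡k above⁺ extra ⟩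
    r
      ∎
    where
      u⁺≡ : toℕ (incMod u) ≡ suc (toℕ u)
      u⁺≡ = toℕ-incMod u (subst (toℕ u <_) u+d⁺≡k (m<m+n (toℕ u) (s≤s z≤n)))
      u<u⁺ : u <ᶠ incMod u
      u<u⁺ = ≤-reflexive (sym u⁺≡)
      above⁺ : InvalidAbove (incMod u)
      above⁺ v u⁺<v = above v (<-trans u<u⁺ u⁺<v)
      u⁺+d≡k : toℕ (incMod u) + d ≡ k
      u⁺+d≡k = trans (cong (_+ d) u⁺≡) (trans (sym (+-suc (toℕ u) d)) u+d⁺≡k)

  toggleValue-raise : ∀ {i e} → toℕ i ≡ toℕ e → toggleValue i e ≡ validOr (suc i) e
  toggleValue-raise {i} {e} i≡e with toℕ i ≟ toℕ e
  ... | yes _  = refl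
  ... | no i≢e = contradiction i≡e i≢e

  toggleValue-lower : ∀ {i e} → suc (toℕ i) ≡ toℕ e → toggleValue i e ≡ validOr (inject₁ i) e
  toggleValue-lower {i} {e} i⁺≡e with toℕ i ≟ toℕ e | suc (toℕ i) ≟ toℕ e
  ... | yes i≡e | _       = contradiction (trans i⁺≡e (sym i≡e)) (>⇒≢ (n<1+n (toℕ i)))
  ... | no _    | yes _   = refl
  ... | no _    | no i⁺≢e = contradiction i⁺≡e i⁺≢e

  toggleValue-idle : ∀ {i e} → toℕ i ≢ toℕ e → suc (toℕ i) ≢ toℕ e → toggleValue i e ≡ e
  toggleValue-idle {i} {e} i≢e i⁺≢e with toℕ i ≟ toℕ e | suc (toℕ i) ≟ toℕ e
  ... | yes i≡e | _        = contradiction i≡e i≢e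
  ... | no _    | yes i⁺≡e = contradiction i⁺≡e i⁺≢e
  ... | no _    | no _     = refl

  sweepUpTo-suc : ∀ {n} (n<k : n < k) → sweepUpTo (suc n) ≡ sweepUpTo n ∘ toggleValue (fromℕ< n<k)
  sweepUpTo-suc {n} n<k = begin
    foldr step id (take (suc n) (allFin k))
      ≡⟨ cong (foldr step id) take-suc ⟩
    foldr step id (take n (allFin k) ∷ʳ i)
      ≡⟨ foldr-∷ʳ step id i (take n (allFin k)) ⟩
    foldr step (toggleValue i) (take n (allFin k))
      ≡⟨ foldr-fusion (_∘ toggleValue i) id (λ _ _ → refl) (take n (allFin k)) ⟨
    sweepUpTo n ∘ toggleValue i
      ∎
    where
      step : Fin k → (Fin (suc k) → Fin (suc k)) → Fin (suc k) → Fin (suc k)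
      step i g = toggleValue i ∘ g
      i : Fin k
      i = fromℕ< n<k
      take-suc : take (suc n) (allFin k) ≡ take n (allFin k) ∷ʳ i
      take-suc = subst (λ m → take (suc m) (allFin k) ≡ take m (allFin k) ∷ʳ i)
                       (toℕ-fromℕ< n<k) (take-suc-tabulate id i)

  sweepUpTo-all : sweepUpTo k ≡ sweepValue
  sweepUpTo-all =
    cong (foldr (λ i g → toggleValue i ∘ g) id) (take-all k (allFin k) (≤-reflexive (length-tabulate id)))

  sweepUpTo-raise : ∀ {n e} (n<k : n < k) → n ≡ toℕ e →
                    sweepUpTo (suc n) e ≡ sweepUpTo n (validOr (suc (fromℕ< n<k)) e)
  sweepUpTo-raise {n} n<k n≡e =
    trans (cong-app (sweepUpTo-suc n<k) _) (cong (sweepUpTo n) (toggleValue-raise (trans (toℕ-fromℕ< n<k) n≡e)))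

  sweepUpTo-lower : ∀ {n e} (n<k : n < k) → suc n ≡ toℕ e →
                    sweepUpTo (suc n) e ≡ sweepUpTo n (validOr (inject₁ (fromℕ< n<k)) e)
  sweepUpTo-lower {n} n<k n⁺≡e =
    trans (cong-app (sweepUpTo-suc n<k) _)
          (cong (sweepUpTo n) (toggleValue-lower (trans (cong suc (toℕ-fromℕ< n<k)) n⁺≡e)))

  sweepUpTo-idle : ∀ {n e} (n<k : n < k) → n ≢ toℕ e → suc n ≢ toℕ e →
                   sweepUpTo (suc n) e ≡ sweepUpTo n e
  sweepUpTo-idle {n} n<k n≢e n⁺≢e =
    trans (cong-app (sweepUpTo-suc n<k) _)
          (cong (sweepUpTo n) (toggleValue-idle (subst (_≢ _) (sym i≡n) n≢e)
                                                (subst (λ m → suc m ≢ _) (sym i≡n) n⁺≢e)))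
    where
      i≡n : toℕ (fromℕ< n<k) ≡ n
      i≡n = toℕ-fromℕ< n<k

  sweepUpTo-below : ∀ n {e} → n < toℕ e → sweepUpTo n e ≡ e
  sweepUpTo-below zero    _     = refl
  sweepUpTo-below (suc n) {e} n⁺<e =
    trans (sweepUpTo-idle n<k (<⇒≢ n<e) (<⇒≢ n⁺<e)) (sweepUpTo-below n n<e)
    where
      n<e : n < toℕ e
      n<e = <-trans (n<1+n n) n⁺<e
      n<k : n < k
      n<k = <-≤-trans n<e (toℕ≤pred[n] e)

  sweepUpTo-above : ∀ n {e} → toℕ e < n → n ≤ k → sweepUpTo n e ≡ sweepUpTo (suc (toℕ e)) e
  sweepUpTo-above (suc n) {e} e<n⁺ n<k with m≤n⇒m<n∨m≡n (≤-pred e<n⁺)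
  ... | inj₂ e≡n = cong (λ m → sweepUpTo (suc m) e) (sym e≡n)
  ... | inj₁ e<n =
    trans (sweepUpTo-idle n<k (>⇒≢ e<n) (>⇒≢ (m<n⇒m<1+n e<n))) (sweepUpTo-above n e<n (<⇒≤ n<k))

  sweepUpTo-at : Convex → ∀ {r} → Least r → ∀ n {e} → toℕ e ≡ n → V e → sweepUpTo n e ≡ r
  sweepUpTo-at _ least zero e≡0 ve =
    least-unique (ve , λ v v<e → contradiction (subst (toℕ v <_) e≡0 v<e) λ ()) least
  sweepUpTo-at convex {r} least (suc n) {e} e≡n⁺ ve =
    trans (sweepUpTo-lower n<k (sym e≡n⁺)) (validOr-elim (λ v → sweepUpTo n v ≡ r) step-down stay)
    where
      n<k : n < k
      n<k = ≤-trans (≤-reflexive (sym e≡n⁺)) (toℕ≤pred[n] e)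
      e⁻ : Fin (suc k)
      e⁻ = inject₁ (fromℕ< n<k)
      e⁻≡n : toℕ e⁻ ≡ n
      e⁻≡n = trans (toℕ-inject₁ _) (toℕ-fromℕ< n<k)
      step-down : V e⁻ → sweepUpTo n e⁻ ≡ r
      step-down = sweepUpTo-at convex least n e⁻≡n
      stay : ¬ V e⁻ → sweepUpTo n e ≡ r
      stay ¬ve⁻ = trans (sweepUpTo-below n (≤-reflexive (sym e≡n⁺)))
        (least-unique (ve , invalidBelow-convex convex ve ¬ve⁻ (trans (cong suc e⁻≡n) (sym e≡n⁺))) least)

  sweepValue-top : ∀ {c} (c<k : toℕ c < k) →
                   sweepValue c ≡ sweepUpTo (toℕ c) (validOr (suc (fromℕ< c<k)) c)
  sweepValue-top {c} c<k = begin
    sweepValue c                                       ≡⟨ cong-app sweepUpTo-all c ⟨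
    sweepUpTo k c                                      ≡⟨ sweepUpTo-above k c<k ≤-refl ⟩
    sweepUpTo (suc (toℕ c)) c                          ≡⟨ sweepUpTo-raise c<k refl ⟩
    sweepUpTo (toℕ c) (validOr (suc (fromℕ< c<k)) c)   ∎

  sweepValue-fall : Convex → ∀ {r c} → Least r → V c → InvalidAbove c → sweepValue c ≡ r
  sweepValue-fall convex {r} {c} least vc above with m≤n⇒m<n∨m≡n (toℕ≤pred[n] c)
  ... | inj₁ c<k = begin
    sweepValue c
      ≡⟨ sweepValue-top c<k ⟩
    sweepUpTo (toℕ c) (validOr (suc (fromℕ< c<k)) c)
      ≡⟨ cong (sweepUpTo (toℕ c)) (validOr-invalid (above _ c<c⁺)) ⟩
    sweepUpTo (toℕ c) c
      ≡⟨ sweepUpTo-at convex least (toℕ c) refl vc ⟩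
    r
      ∎
    where
      c<c⁺ : c <ᶠ suc (fromℕ< c<k)
      c<c⁺ = s≤s (≤-reflexive (sym (toℕ-fromℕ< c<k)))
  ... | inj₂ c≡k = trans (sym (cong-app sweepUpTo-all c)) (sweepUpTo-at convex least k c≡k vc)

  wValue-fall : ∀ {r c} → Least r → V c → InvalidAbove c → wValue (suc k) c ≡ r
  wValue-fall {r} {c} least@(_ , below) vc above = begin
    wValue (suc k) c
      ≡⟨ cong (λ m → wValue (suc m) c) fuel ⟨
    wValue (suc (k ∸ toℕ c + toℕ r + (toℕ c ∸ toℕ r))) c
      ≡⟨ wValue-wrap least (k ∸ toℕ c) c (m+[n∸m]≡n c≤k) above _ ⟩
    r
      ∎
    where
      c≤k : toℕ c ≤ k
      c≤k = toℕ≤pred[n] c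
      r≤c : toℕ r ≤ toℕ c
      r≤c = ≮⇒≥ λ c<r → below c c<r vc
      fuel : k ∸ toℕ c + toℕ r + (toℕ c ∸ toℕ r) ≡ k
      fuel = begin
        k ∸ toℕ c + toℕ r + (toℕ c ∸ toℕ r)    ≡⟨ +-assoc (k ∸ toℕ c) (toℕ r) _ ⟩
        k ∸ toℕ c + (toℕ r + (toℕ c ∸ toℕ r))  ≡⟨ cong (k ∸ toℕ c +_) (m+[n∸m]≡n r≤c) ⟩
        k ∸ toℕ c + toℕ c                      ≡⟨ m∸n+n≡m c≤k ⟩
        k                                      ∎

  wValue≡sweepValue-fall : Convex → ∀ {c} → V c → InvalidAbove c → wValue (suc k) c ≡ sweepValue c
  wValue≡sweepValue-fall convex vc above with least-exists vc
  ... | _ , least = trans (wValue-fall least vc above) (sym (sweepValue-fall convex least vc above))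

  wValue≡sweepValue-raise : ∀ {c} (c<k : toℕ c < k) → V (suc (fromℕ< c<k)) →
                            wValue (suc k) c ≡ sweepValue c
  wValue≡sweepValue-raise {c} c<k vc⁺ = begin
    wValue (suc k) c                  ≡⟨ cong (λ v → validOr v (wValue k v)) (toℕ-injective c⁺≡) ⟩
    validOr c⁺ (wValue k c⁺)          ≡⟨ validOr-valid vc⁺ ⟩
    c⁺                                ≡⟨ sweepUpTo-below (toℕ c) (≤-reflexive (sym c⁺≡c+1)) ⟨
    sweepUpTo (toℕ c) c⁺              ≡⟨ cong (sweepUpTo (toℕ c)) (validOr-valid vc⁺) ⟨
    sweepUpTo (toℕ c) (validOr c⁺ c)  ≡⟨ sweepValue-top c<k ⟨
    sweepValue c                      ∎
    where
      c⁺ : Fin (suc k)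
      c⁺ = suc (fromℕ< c<k)
      c⁺≡c+1 : toℕ c⁺ ≡ suc (toℕ c)
      c⁺≡c+1 = cong suc (toℕ-fromℕ< c<k)
      c⁺≡ : toℕ (incMod c) ≡ toℕ c⁺
      c⁺≡ = trans (toℕ-incMod c c<k) (sym c⁺≡c+1)

  wValue≡sweepValue : Convex → ∀ {c} → V c → wValue (suc k) c ≡ sweepValue c
  wValue≡sweepValue convex {c} vc with toℕ c <? k
  ... | no c≮k = wValue≡sweepValue-fall convex vc λ v c<v _ → c≮k (<-≤-trans c<v (toℕ≤pred[n] v))
  ... | yes c<k with V? (suc (fromℕ< c<k))
  ...   | yes vc⁺ = wValue≡sweepValue-raise c<k vc⁺
  ...   | no ¬vc⁺ =
    wValue≡sweepValue-fall convex vc (invalidAbove-convex convex vc ¬vc⁺ (cong suc (sym (toℕ-fromℕ< c<k))))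

module _ (P : FinPoset) {k : ℕ} where
  open FinPoset P

  ideal-≼ : ∀ (I : Sub P k) → IsIdeal P k I → ∀ {x y} → x ≤P y → lookup I y ≼ lookup I x
  ideal-≼ _ hI {x} {y} x≤y i j = hI x y i j x≤y

  ideal-downClosed : ∀ (I : Sub P k) → IsIdeal P k I → ∀ x → DownClosed (lookup I x)
  ideal-downClosed I hI x = ideal-≼ I hI (IsDecPartialOrder.refl isDecPartialOrder)

  isIdeal-idealOf : ∀ g → InF P k g → IsIdeal P k (idealOf g)
  isIdeal-idealOf g hg x y i j x≤y
    rewrite lookup-map x segment g | lookup-map y segment g = segment-≼ (hg x y x≤y) i j

  isIdeal-idealOf⁻¹ : ∀ g → IsIdeal P k (idealOf g) → InF P k g
  isIdeal-idealOf⁻¹ g hI x y x≤y =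
    segment-≼⁻¹ (subst₂ _≼_ (lookup-map y segment g) (lookup-map x segment g)
                            (ideal-≼ (idealOf g) hI x≤y))

  isIdeal-idealOf⇔InF : ∀ {g} → IsIdeal P k (idealOf g) ⇔ InF P k g
  isIdeal-idealOf⇔InF {g} = mk⇔ (isIdeal-idealOf⁻¹ g) (isIdeal-idealOf g)

  idealOf-surjective : ∀ I → IsIdeal P k I → Σ (Vec (Fin (suc k)) size) λ g → InF P k g × idealOf g ≡ I
  idealOf-surjective I hI = fromIdeal I , isIdeal-idealOf⁻¹ (fromIdeal I) (subst (IsIdeal P k) (sym eq) hI) , eq
    where
      eq : idealOf (fromIdeal I) ≡ I
      eq = idealOf-fromIdeal I (ideal-downClosed I hI)

  idealOr : Sub P k → Sub P k → Sub P k
  idealOr J I = if does (IsIdeal? P k J) then J else I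

  idealOr-reject : ∀ {J I} → ¬ IsIdeal P k J → idealOr J I ≡ I
  idealOr-reject {J} {I} ¬J = cong (λ b → if b then J else I) (dec-false (IsIdeal? P k J) ¬J)

  toggle-flip : ∀ x i (I : Sub P k) {b} → lookup (lookup I x) i ≡ b →
                toggle P k x i I ≡ idealOr (setAt P x i (not b) I) I
  toggle-flip x i I {true}  eq rewrite eq = refl
  toggle-flip x i I {false} eq rewrite eq = refl

module Update (P : FinPoset) {k : ℕ} (f : Vec (Fin (suc k)) (FinPoset.size P)) (x : Fin (FinPoset.size P)) where
  open FinPoset P

  Valid : Fin (suc k) → Set
  Valid v = InF P k (f [ x ]≔ v)

  open Column Valid (λ v → InF? P k (f [ x ]≔ v)) public

  valid-convex : Convex
  valid-convex {u} {v} {t} vu vt u≤v v≤t y z y≤z with y ≟ᶠ x | z ≟ᶠ x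
  ... | yes refl | yes refl = ≤-refl
  ... | yes refl | no z≢x rewrite lookup∘update x f v | lookup∘update′ z≢x f v =
    ≤-trans (subst₂ _≤ᶠ_ (lookup∘update′ z≢x f u) (lookup∘update x f u) (vu x z y≤z)) u≤v
  ... | no y≢x | yes refl rewrite lookup∘update x f v | lookup∘update′ y≢x f v =
    ≤-trans v≤t (subst₂ _≤ᶠ_ (lookup∘update x f t) (lookup∘update′ y≢x f t) (vt y x y≤z))
  ... | no y≢x | no z≢x rewrite lookup∘update′ z≢x f v | lookup∘update′ y≢x f v =
    subst₂ _≤ᶠ_ (lookup∘update′ z≢x f u) (lookup∘update′ y≢x f u) (vu y z y≤z)

  wStep-suc : ∀ m g → wStep P k x (suc m) g ≡
              (if does (InF? P k (g [ x ]%= incMod)) then g [ x ]%= incMod else wStep P k x m (g [ x ]%= incMod))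
  wStep-suc m g with does (InF? P k (g [ x ]%= incMod))
  ... | true  = refl
  ... | false = refl

  wStep-update : ∀ m u → wStep P k x m (f [ x ]≔ u) ≡ f [ x ]≔ wValue m u
  wStep-update zero    u = refl
  wStep-update (suc m) u = begin
    wStep P k x (suc m) (f [ x ]≔ u)
      ≡⟨ wStep-suc m (f [ x ]≔ u) ⟩
    (if does (InF? P k ((f [ x ]≔ u) [ x ]%= incMod)) then (f [ x ]≔ u) [ x ]%= incMod
     else wStep P k x m ((f [ x ]≔ u) [ x ]%= incMod))
      ≡⟨ cong (λ g → if does (InF? P k g) then g else wStep P k x m g) (updateAt-updateAt x f) ⟩
    (if does (InF? P k (f [ x ]≔ u⁺)) then f [ x ]≔ u⁺ else wStep P k x m (f [ x ]≔ u⁺))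
      ≡⟨ if-cong-else (does (InF? P k (f [ x ]≔ u⁺))) (wStep-update m u⁺) ⟩
    (if does (InF? P k (f [ x ]≔ u⁺)) then f [ x ]≔ u⁺ else f [ x ]≔ wValue m u⁺)
      ≡⟨ if-float (f [ x ]≔_) (does (InF? P k (f [ x ]≔ u⁺))) ⟨
    f [ x ]≔ wValue (suc m) u
      ∎
    where
      u⁺ : Fin (suc k)
      u⁺ = incMod u

  idealOf-update : ∀ e → idealOf (f [ x ]≔ e) ≡ idealOf f [ x ]≔ segment e
  idealOf-update e = map-[]≔ segment f x

  toggle-row : ∀ i r → toggle P k x i (idealOf f [ x ]≔ r)
                       ≡ idealOr P (idealOf f [ x ]≔ (r [ i ]%= not)) (idealOf f [ x ]≔ r)
  toggle-row i r = begin
    toggle P k x i (idealOf f [ x ]≔ r)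
      ≡⟨ toggle-flip P x i _ (cong (λ s → lookup s i) (lookup∘update x (idealOf f) r)) ⟩
    idealOr P (setAt P x i (not (lookup r i)) (idealOf f [ x ]≔ r)) (idealOf f [ x ]≔ r)
      ≡⟨ cong (λ J → idealOr P J _) (updateAt-updateAt-local x (idealOf f) (updateAt-cong-local i r refl)) ⟩
    idealOr P (idealOf f [ x ]≔ (r [ i ]%= not)) (idealOf f [ x ]≔ r)
      ∎

  idealOr-idealOf : ∀ d e → idealOr P (idealOf (f [ x ]≔ d)) (idealOf (f [ x ]≔ e))
                            ≡ idealOf (f [ x ]≔ validOr d e)
  idealOr-idealOf d e = begin
    (if does (IsIdeal? P k (idealOf (f [ x ]≔ d))) then idealOf (f [ x ]≔ d) else idealOf (f [ x ]≔ e))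
      ≡⟨ cong (λ b → if b then idealOf (f [ x ]≔ d) else idealOf (f [ x ]≔ e)) does≡ ⟩
    (if does (InF? P k (f [ x ]≔ d)) then idealOf (f [ x ]≔ d) else idealOf (f [ x ]≔ e))
      ≡⟨ if-float (λ v → idealOf (f [ x ]≔ v)) (does (InF? P k (f [ x ]≔ d))) ⟨
    idealOf (f [ x ]≔ validOr d e)
      ∎
    where
      does≡ : does (IsIdeal? P k (idealOf (f [ x ]≔ d))) ≡ does (InF? P k (f [ x ]≔ d))
      does≡ = does-⇔ (isIdeal-idealOf⇔InF P {g = f [ x ]≔ d})
                     (IsIdeal? P k (idealOf (f [ x ]≔ d))) (InF? P k (f [ x ]≔ d))

  toggle-move : ∀ i e d → segment e [ i ]%= not ≡ segment d →
                toggle P k x i (idealOf (f [ x ]≔ e)) ≡ idealOf (f [ x ]≔ validOr d e)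
  toggle-move i e d flip≡ = begin
    toggle P k x i (idealOf (f [ x ]≔ e))
      ≡⟨ cong (toggle P k x i) (idealOf-update e) ⟩
    toggle P k x i (idealOf f [ x ]≔ segment e)
      ≡⟨ toggle-row i (segment e) ⟩
    idealOr P (idealOf f [ x ]≔ (segment e [ i ]%= not)) (idealOf f [ x ]≔ segment e)
      ≡⟨ cong₂ (idealOr P) (trans (cong (idealOf f [ x ]≔_) flip≡) (sym (idealOf-update d)))
                           (sym (idealOf-update e)) ⟩
    idealOr P (idealOf (f [ x ]≔ d)) (idealOf (f [ x ]≔ e))
      ≡⟨ idealOr-idealOf d e ⟩
    idealOf (f [ x ]≔ validOr d e)
      ∎

  toggle-stuck : ∀ i e → ¬ DownClosed (segment e [ i ]%= not) →
                 toggle P k x i (idealOf (f [ x ]≔ e)) ≡ idealOf (f [ x ]≔ e)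
  toggle-stuck i e ¬closed = begin
    toggle P k x i (idealOf (f [ x ]≔ e))
      ≡⟨ cong (toggle P k x i) (idealOf-update e) ⟩
    toggle P k x i (idealOf f [ x ]≔ segment e)
      ≡⟨ toggle-row i (segment e) ⟩
    idealOr P (idealOf f [ x ]≔ (segment e [ i ]%= not)) (idealOf f [ x ]≔ segment e)
      ≡⟨ idealOr-reject P not-ideal ⟩
    idealOf f [ x ]≔ segment e
      ≡⟨ idealOf-update e ⟨
    idealOf (f [ x ]≔ e)
      ∎
    where
      flipped : Vec Bool k
      flipped = segment e [ i ]%= not
      not-ideal : ¬ IsIdeal P k (idealOf f [ x ]≔ flipped)
      not-ideal hJ = ¬closed (subst DownClosed (lookup∘update x (idealOf f) flipped)
                                                (ideal-downClosed P (idealOf f [ x ]≔ flipped) hJ x))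

  toggle-idealOf : ∀ i e → toggle P k x i (idealOf (f [ x ]≔ e)) ≡ idealOf (f [ x ]≔ toggleValue i e)
  toggle-idealOf i e with toℕ i ≟ toℕ e | suc (toℕ i) ≟ toℕ e
  ... | yes i≡e | _ = toggle-move i e (suc i)
    (subst (λ e → segment e [ i ]%= not ≡ segment (suc i))
           (toℕ-injective (trans (toℕ-inject₁ i) i≡e)) (segment-raise i))
  ... | no _ | yes i⁺≡e = toggle-move i e (inject₁ i)
    (subst (λ e → segment e [ i ]%= not ≡ segment (inject₁ i)) (toℕ-injective i⁺≡e) (segment-lower i))
  ... | no i≢e | no i⁺≢e =
    toggle-stuck i e ([ segment-flip-above , segment-flip-below ]′ (away-from-neighbours i≢e i⁺≢e))

  toggles-idealOf : ∀ is e → foldr (λ i g → toggle P k x i ∘ g) id is (idealOf (f [ x ]≔ e))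
                             ≡ idealOf (f [ x ]≔ foldr (λ i g → toggleValue i ∘ g) id is e)
  toggles-idealOf []       e = refl
  toggles-idealOf (i ∷ is) e = trans (cong (toggle P k x i) (toggles-idealOf is e)) (toggle-idealOf i _)

  idealOf-w : InF P k f → idealOf (w P k x f) ≡ toggleCol P k x (idealOf f)
  idealOf-w hf = begin
    idealOf (w P k x f)                     ≡⟨ cong (idealOf ∘ w P k x) f≡ ⟩
    idealOf (w P k x (f [ x ]≔ c))          ≡⟨ cong idealOf (wStep-update (suc k) c) ⟩
    idealOf (f [ x ]≔ wValue (suc k) c)     ≡⟨ cong (idealOf ∘ (f [ x ]≔_)) (wValue≡sweepValue valid-convex vc) ⟩
    idealOf (f [ x ]≔ sweepValue c)         ≡⟨ toggles-idealOf (allFin k) c ⟨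
    toggleCol P k x (idealOf (f [ x ]≔ c))  ≡⟨ cong (toggleCol P k x ∘ idealOf) f≡ ⟨
    toggleCol P k x (idealOf f)             ∎
    where
      c : Fin (suc k)
      c = lookup f x
      f≡ : f ≡ f [ x ]≔ c
      f≡ = sym ([]≔-lookup f x)
      vc : Valid c
      vc = subst (InF P k) f≡ hf

lemma2p11 : (P : FinPoset) (k : ℕ) → 1 ≤ k →
  Σ (Vec (Fin (suc k)) (FinPoset.size P) → Sub P k) λ φ →
    ((f : Vec (Fin (suc k)) (FinPoset.size P)) → InF P k f → IsIdeal P k (φ f))
    × ((f g : Vec (Fin (suc k)) (FinPoset.size P)) → InF P k f → InF P k g → φ f ≡ φ g → f ≡ g)
    × ((I : Sub P k) → IsIdeal P k I →
         Σ (Vec (Fin (suc k)) (FinPoset.size P)) λ f → InF P k f × φ f ≡ I)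
    × ((f : Vec (Fin (suc k)) (FinPoset.size P)) → InF P k f →
         (x : Fin (FinPoset.size P)) → φ (w P k x f) ≡ toggleCol P k x (φ f))
lemma2p11 P k _ =
  idealOf , isIdeal-idealOf P , (λ _ _ _ _ → idealOf-injective) , idealOf-surjective P ,
  λ f hf x → Update.idealOf-w P f x hf
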